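{- Let $l\ge1$ and let $(u_1,\dots,u_l),(v_1,\dots,v_l)\in\{y,z\}^l$ be cyclically equivalent, i.e. there is $j\in\mathbb{Z}$ with $v_i=u_{i+j}$ for all $i$ (indices taken modulo $l$). Then $\rho_0(u_1\cdots u_l)=\rho_0(v_1\cdots v_l)$; consequently $\tilde{\rho}_0([(u_1,\dots,u_l)])=\rho_0(u_1\cdots u_l)$ gives a well-defined map from the set of cyclic equivalence classes of $\{y,z\}^l$ to $\mathfrak{H}$.
   Context: Let $\mathfrak{H}=\mathbb{Q}\langle x,y\rangle$ be the noncommutative polynomial algebra over $\mathbb{Q}$ in $x,y$, and $z=x+y$. Make $\mathfrak{H}\otimes\mathfrak{H}$ an $\mathfrak{H}$-bimodule via $a\diamond(w_1\otimes w_2)\diamond b=w_1b\otimes aw_2$. Let $\mathcal{C}_0\colon\mathfrak{H}\to\mathfrak{H}\otimes\mathfrak{H}$ be the $\mathbb{Q}$-linear map with $\mathcal{C}_0(1)=0$, $\mathcal{C}_0(x)=x\otimes y$, $\mathcal{C}_0(y)=-x\otimes y$, $\mathcal{C}_0(ww')=\mathcal{C}_0(w)\diamond w'+w\diamond\mathcal{C}_0(w')$, and $\rho_0=M_0\circ\mathcal{C}_0$ with $M_0(w_1\otimes w_2)=w_1w_2$. Cyclic equivalence on $\{y,z\}^l$ is the equivalence relation induced by the action of $\mathbb{Z}/l\mathbb{Z}$ by cyclic shifts $j(u_1,\dots,u_l)=(u_{j+1},\dots,u_{j+l})$. -}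

module Defs where

open import Data.Nat using (ℕ; NonZero)
open import Data.Integer using (ℤ; +_; _%ℕ_)
import Data.Integer as ℤ
open import Data.Integer.DivMod using (n%ℕd<d)
open import Data.Fin using (Fin; toℕ; fromℕ<)
open import Data.Vec using (Vec; lookup; foldr′)
open import Data.Rational using (ℚ; 0ℚ; 1ℚ; -_; _+_; _*_)
open import Data.List using (List; []; _∷_; [_]; _++_; map; concatMap; foldr)
import Data.List.Properties as LP
open import Data.Product using (_×_; _,_)
open import Relation.Binary.PropositionalEquality using (_≡_; refl)
open import Relation.Nullary using (Dec; yes; no)

data Letter : Set where
  𝕩 𝕪 : Letter

_≟L_ : (a b : Letter) → Dec (a ≡ b)
𝕩 ≟L 𝕩 = yes refl
𝕩 ≟L 𝕪 = no (λ ())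
𝕪 ≟L 𝕩 = no (λ ())
𝕪 ≟L 𝕪 = yes refl

Word : Set
Word = List Letter

_≟W_ : (u v : Word) → Dec (u ≡ v)
_≟W_ = LP.≡-dec _≟L_

-- Elements of 𝔥 : finite formal ℚ-linear combinations of words
𝔥 : Set
𝔥 = List (ℚ × Word)

coeff : 𝔥 → Word → ℚ
coeff [] w = 0ℚ
coeff ((c , u) ∷ p) w with u ≟W w
... | yes _ = c + coeff p w
... | no  _ = coeff p w

_≈_ : 𝔥 → 𝔥 → Set
p ≈ q = ∀ w → coeff p w ≡ coeff q w

scale : ℚ → 𝔥 → 𝔥
scale c = map (λ { (d , w) → (c * d , w) })

one : 𝔥
one = [ (1ℚ , []) ]

letter : Letter → 𝔥
letter a = [ (1ℚ , [ a ]) ]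

_⊕_ : 𝔥 → 𝔥 → 𝔥
_⊕_ = _++_

_⊛_ : 𝔥 → 𝔥 → 𝔥
p ⊛ q = concatMap (λ { (c , u) → map (λ { (d , v) → (c * d , u ++ v) }) q }) p

-- 𝔥 ⊗ 𝔥 : finite formal ℚ-linear combinations of pairs of words
𝔥⊗𝔥 : Set
𝔥⊗𝔥 = List (ℚ × Word × Word)

-- bimodule structure a ⋄ (w₁ ⊗ w₂) ⋄ b = w₁ b ⊗ a w₂ (on words, extended linearly)
_⋄ʳ_ : 𝔥⊗𝔥 → Word → 𝔥⊗𝔥
m ⋄ʳ b = map (λ { (c , w₁ , w₂) → (c , w₁ ++ b , w₂) }) m

_⋄ˡ_ : Word → 𝔥⊗𝔥 → 𝔥⊗𝔥
a ⋄ˡ m = map (λ { (c , w₁ , w₂) → (c , w₁ , a ++ w₂) }) m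

𝒞₀-letter : Letter → 𝔥⊗𝔥
𝒞₀-letter 𝕩 = [ (1ℚ , [ 𝕩 ] , [ 𝕪 ]) ]
𝒞₀-letter 𝕪 = [ (- 1ℚ , [ 𝕩 ] , [ 𝕪 ]) ]

𝒞₀-word : Word → 𝔥⊗𝔥
𝒞₀-word [] = []
𝒞₀-word (a ∷ w) = (𝒞₀-letter a ⋄ʳ w) ++ ([ a ] ⋄ˡ 𝒞₀-word w)

𝒞₀ : 𝔥 → 𝔥⊗𝔥
𝒞₀ p = concatMap (λ { (c , w) → map (λ { (d , w₁ , w₂) → (c * d , w₁ , w₂) }) (𝒞₀-word w) }) p

M₀ : 𝔥⊗𝔥 → 𝔥
M₀ = map (λ { (c , w₁ , w₂) → (c , w₁ ++ w₂) })

ρ₀ : 𝔥 → 𝔥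
ρ₀ p = M₀ (𝒞₀ p)

data YZ : Set where
  𝕐 ℤ' : YZ

toH : YZ → 𝔥
toH 𝕐  = letter 𝕪
toH ℤ' = letter 𝕩 ⊕ letter 𝕪

prodYZ : ∀ {l} → Vec YZ l → 𝔥
prodYZ = foldr′ (λ a p → toH a ⊛ p) one

-- index i + j taken modulo l (indices 0-based)
shiftIdx : (l : ℕ) → {{_ : NonZero l}} → ℤ → Fin l → Fin l
shiftIdx l j i = fromℕ< (n%ℕd<d ((+ toℕ i) ℤ.+ j) l)

CyclicEquiv : (l : ℕ) → {{_ : NonZero l}} → Vec YZ l → Vec YZ l → Set
CyclicEquiv l u v = Data.Product.∃ λ (j : ℤ) → ∀ (i : Fin l) → lookup v i ≡ lookup u (shiftIdx l j i)

-- ρ₀ sends a word a₁⋯aₙ to Σᵢ ±x aᵢ₊₁⋯aₙ a₁⋯aᵢ₋₁ y, one term per position of the cyclic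
-- word, so ρ₀(uv) and ρ₀(vu) consist of the same terms in a different order: ρ₀ is a trace,
-- ρ₀(pq) = ρ₀(qp).  A cyclic shift of (u₁, …, u_l) splits the product as pq and the shifted
-- product as qp, hence both have the same image.
module Submission where

open import Defs
open import Data.Nat as ℕ using (ℕ; zero; suc; NonZero; _<_; _≤_; s≤s; _<?_)
import Data.Nat.Properties as ℕₚ
open import Data.Nat.DivMod using (_%_; _/_; m≡m%n+[m/n]*n; m%n<n; m<n⇒m%n≡m; [m+n]%n≡m%n)
open import Data.Nat.Tactic.RingSolver as ℕ-Solver using ()
open import Data.Integer as ℤ using (ℤ; +_; ∣_∣; _%ℕ_; _/ℕ_)
import Data.Integer.Properties as ℤₚ
open import Data.Integer.DivMod using (n%ℕd<d; a≡a%ℕn+[a/ℕn]*n)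
open import Data.Integer.Tactic.RingSolver as ℤ-Solver using ()
open import Data.Rational using (ℚ; 0ℚ; 1ℚ; -_; _+_; _*_)
import Data.Rational.Properties as ℚₚ
open import Data.Fin using (Fin; toℕ; fromℕ<)
import Data.Fin.Properties as Finₚ
open import Data.Vec using (Vec; lookup; toList)
import Data.Vec as Vec
import Data.Vec.Properties as Vecₚ
open import Data.List using (List; []; _∷_; [_]; _++_; length; take; drop; map; concatMap; foldr)
open import Data.List.Properties
  using (map-∘; map-cong; map-id; concatMap-++; concatMap-map; map-concatMap; concatMap-cong;
         ++-identityʳ; ++-assoc; length-++; length-++-comm; length-take; take++drop≡id)
open import Data.List.Relation.Binary.Permutation.Propositional
  using (_↭_; ↭-refl; ↭-sym; ↭-trans; ↭-reflexive; ↭⇒↭ₛ; module PermutationReasoning)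
open import Data.List.Relation.Binary.Permutation.Propositional.Properties
  using (++⁺; ++⁺ˡ; ++-comm; shifts; map⁺)
open import Data.List.Relation.Binary.Permutation.Setoid.Properties using (foldr-commMonoid)
open import Data.Maybe using (Maybe; just; nothing)
open import Data.Product using (Σ-syntax; _×_; _,_)
open import Function using (_∘_)
open import Relation.Binary.PropositionalEquality
  using (_≡_; refl; sym; trans; cong; cong₂; subst; subst₂; setoid; module ≡-Reasoning)
open import Relation.Nullary using (yes; no; contradiction)

coeffOf : Word → ℚ × Word → ℚ
coeffOf w (c , u) with u ≟W w
... | yes _ = c
... | no  _ = 0ℚ

coeff≡sum : ∀ p w → coeff p w ≡ foldr _+_ 0ℚ (map (coeffOf w) p)
coeff≡sum []            w = refl
coeff≡sum ((c , u) ∷ p) w with u ≟W w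
... | yes _ = cong (_+_ c) (coeff≡sum p w)
... | no  _ = trans (coeff≡sum p w) (sym (ℚₚ.+-identityˡ _))

↭⇒≈ : ∀ {p q} → p ↭ q → p ≈ q
↭⇒≈ {p} {q} p↭q w = begin
  coeff p w                         ≡⟨ coeff≡sum p w ⟩
  foldr _+_ 0ℚ (map (coeffOf w) p)  ≡⟨ foldr-commMonoid (setoid ℚ) ℚₚ.+-0-isCommutativeMonoid
                                         (↭⇒↭ₛ (map⁺ (coeffOf w) p↭q)) ⟩
  foldr _+_ 0ℚ (map (coeffOf w) q)  ≡⟨ coeff≡sum q w ⟨
  coeff q w                         ∎
  where open ≡-Reasoning

module _ {A B C : Set} where

  concatMap-concatMap : ∀ (f : B → List C) (g : A → List B) xs →
                        concatMap f (concatMap g xs) ≡ concatMap (λ x → concatMap f (g x)) xs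
  concatMap-concatMap f g []       = refl
  concatMap-concatMap f g (x ∷ xs) =
    trans (concatMap-++ f (g x) _) (cong (concatMap f (g x) ++_) (concatMap-concatMap f g xs))

module _ {A B : Set} where

  concatMap⁺ : ∀ {f g : A → List B} → (∀ x → f x ↭ g x) → ∀ xs → concatMap f xs ↭ concatMap g xs
  concatMap⁺ f↭g []       = ↭-refl
  concatMap⁺ f↭g (x ∷ xs) = ++⁺ (f↭g x) (concatMap⁺ f↭g xs)

  concatMap-++-↭ : ∀ (f g : A → List B) xs →
                   concatMap (λ x → f x ++ g x) xs ↭ concatMap f xs ++ concatMap g xs
  concatMap-++-↭ f g []       = ↭-refl
  concatMap-++-↭ f g (x ∷ xs) = begin
    (f x ++ g x) ++ concatMap (λ x → f x ++ g x) xs   ≡⟨ ++-assoc (f x) (g x) _ ⟩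
    f x ++ g x ++ concatMap (λ x → f x ++ g x) xs     ↭⟨ ++⁺ˡ (f x) (++⁺ˡ (g x) (concatMap-++-↭ f g xs)) ⟩
    f x ++ g x ++ concatMap f xs ++ concatMap g xs    ↭⟨ ++⁺ˡ (f x) (shifts (g x) (concatMap f xs)) ⟩
    f x ++ concatMap f xs ++ g x ++ concatMap g xs    ≡⟨ ++-assoc (f x) (concatMap f xs) _ ⟨
    (f x ++ concatMap f xs) ++ g x ++ concatMap g xs  ∎
    where open PermutationReasoning

module _ {A B C : Set} where

  concatMap-comm : ∀ (f : A → B → List C) xs ys →
                   concatMap (λ x → concatMap (f x) ys) xs ↭ concatMap (λ y → concatMap (λ x → f x y) xs) ys
  concatMap-comm f []       ys = ↭-reflexive (sym (concatMap-[] ys))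
    where
    concatMap-[] : ∀ ys → concatMap (λ (_ : B) → [] {A = C}) ys ≡ []
    concatMap-[] []       = refl
    concatMap-[] (_ ∷ ys) = concatMap-[] ys
  concatMap-comm f (x ∷ xs) ys =
    ↭-trans (++⁺ˡ (concatMap (f x) ys) (concatMap-comm f xs ys))
            (↭-sym (concatMap-++-↭ (f x) (λ y → concatMap (λ x → f x y) xs) ys))

sgn : Letter → ℚ
sgn 𝕩 = 1ℚ
sgn 𝕪 = - 1ℚ

-- The terms of ρ₀ of the cyclic word w c coming from the letters of w:
-- for w = w₁ a w₂ the letter a contributes sgn a · x w₂ c w₁ y.
cyclicTerms : Word → Word → 𝔥
cyclicTerms c []      = []
cyclicTerms c (a ∷ w) = (sgn a , 𝕩 ∷ w ++ c ++ [ 𝕪 ]) ∷ cyclicTerms (c ++ [ a ]) w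

⋄ˡ-assoc : ∀ c d (m : 𝔥⊗𝔥) → c ⋄ˡ (d ⋄ˡ m) ≡ (c ++ d) ⋄ˡ m
⋄ˡ-assoc c d []                  = refl
⋄ˡ-assoc c d ((e , w₁ , w₂) ∷ m) =
  cong₂ _∷_ (cong (λ w → e , w₁ , w) (sym (++-assoc c d w₂))) (⋄ˡ-assoc c d m)

M₀-⋄ˡ-𝒞₀-word : ∀ c w → M₀ (c ⋄ˡ 𝒞₀-word w) ≡ cyclicTerms c w
M₀-⋄ˡ-𝒞₀-word c []      = refl
M₀-⋄ˡ-𝒞₀-word c (𝕩 ∷ w) =
  cong₂ _∷_ refl (trans (cong M₀ (⋄ˡ-assoc c [ 𝕩 ] (𝒞₀-word w))) (M₀-⋄ˡ-𝒞₀-word (c ++ [ 𝕩 ]) w))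
M₀-⋄ˡ-𝒞₀-word c (𝕪 ∷ w) =
  cong₂ _∷_ refl (trans (cong M₀ (⋄ˡ-assoc c [ 𝕪 ] (𝒞₀-word w))) (M₀-⋄ˡ-𝒞₀-word (c ++ [ 𝕪 ]) w))

M₀-𝒞₀-word : ∀ w → M₀ (𝒞₀-word w) ≡ cyclicTerms [] w
M₀-𝒞₀-word w = trans (cong M₀ (sym (map-id (𝒞₀-word w)))) (M₀-⋄ˡ-𝒞₀-word [] w)

cyclicTerms-++ : ∀ c u v → cyclicTerms c (u ++ v) ≡ cyclicTerms (v ++ c) u ++ cyclicTerms (c ++ u) v
cyclicTerms-++ c []      v = cong (λ d → cyclicTerms d v) (sym (++-identityʳ c))
cyclicTerms-++ c (a ∷ u) v = cong₂ _∷_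
  (cong (λ w → sgn a , 𝕩 ∷ w) (trans (++-assoc u v _) (cong (u ++_) (sym (++-assoc v c [ 𝕪 ])))))
  (begin
    cyclicTerms (c ++ [ a ]) (u ++ v)
      ≡⟨ cyclicTerms-++ (c ++ [ a ]) u v ⟩
    cyclicTerms (v ++ c ++ [ a ]) u ++ cyclicTerms ((c ++ [ a ]) ++ u) v
      ≡⟨ cong₂ (λ d e → cyclicTerms d u ++ cyclicTerms e v) (sym (++-assoc v c [ a ])) (++-assoc c [ a ] u) ⟩
    cyclicTerms ((v ++ c) ++ [ a ]) u ++ cyclicTerms (c ++ a ∷ u) v
      ∎)
  where open ≡-Reasoning

cyclicTerms-rotate : ∀ u v → cyclicTerms [] (u ++ v) ↭ cyclicTerms [] (v ++ u)
cyclicTerms-rotate u v = begin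
  cyclicTerms [] (u ++ v)                     ≡⟨ cyclicTerms-++ [] u v ⟩
  cyclicTerms (v ++ []) u ++ cyclicTerms u v  ≡⟨ cong (λ c → cyclicTerms c u ++ cyclicTerms u v) (++-identityʳ v) ⟩
  cyclicTerms v u ++ cyclicTerms u v          ↭⟨ ++-comm (cyclicTerms v u) (cyclicTerms u v) ⟩
  cyclicTerms u v ++ cyclicTerms v u          ≡⟨ cong (λ c → cyclicTerms c v ++ cyclicTerms v u) (++-identityʳ u) ⟨
  cyclicTerms (u ++ []) v ++ cyclicTerms v u  ≡⟨ cyclicTerms-++ [] v u ⟨
  cyclicTerms [] (v ++ u)                     ∎
  where open PermutationReasoning

ρ₀-term : ℚ × Word → 𝔥
ρ₀-term (c , w) = scale c (cyclicTerms [] w)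

M₀-scale : ∀ c (m : 𝔥⊗𝔥) → M₀ (map (λ (d , w₁ , w₂) → c * d , w₁ , w₂) m) ≡ scale c (M₀ m)
M₀-scale c m = trans (sym (map-∘ m)) (map-∘ m)

ρ₀-linear : ∀ p → ρ₀ p ≡ concatMap ρ₀-term p
ρ₀-linear p = trans (map-concatMap _ _ p)
  (concatMap-cong (λ (c , w) → trans (M₀-scale c (𝒞₀-word w)) (cong (scale c) (M₀-𝒞₀-word w))) p)

_·_ : ℚ × Word → ℚ × Word → ℚ × Word
(c , u) · (d , v) = c * d , u ++ v

·-assoc : ∀ r s t → (r · s) · t ≡ r · (s · t)
·-assoc (c , u) (d , v) (e , w) = cong₂ _,_ (ℚₚ.*-assoc c d e) (++-assoc u v w)

ρ₀-term-·-comm : ∀ s t → ρ₀-term (s · t) ↭ ρ₀-term (t · s)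
ρ₀-term-·-comm (c , u) (d , v) rewrite ℚₚ.*-comm c d = map⁺ _ (cyclicTerms-rotate u v)

ρ₀-⊛ : ∀ p q → ρ₀ (p ⊛ q) ≡ concatMap (λ s → concatMap (λ t → ρ₀-term (s · t)) q) p
ρ₀-⊛ p q = begin
  ρ₀ (p ⊛ q)                                                ≡⟨ ρ₀-linear (p ⊛ q) ⟩
  concatMap ρ₀-term (concatMap (λ s → map (s ·_) q) p)     ≡⟨ concatMap-concatMap ρ₀-term _ p ⟩
  concatMap (λ s → concatMap ρ₀-term (map (s ·_) q)) p     ≡⟨ concatMap-cong (λ s → concatMap-map ρ₀-term (s ·_) q) p ⟩
  concatMap (λ s → concatMap (λ t → ρ₀-term (s · t)) q) p  ∎
  where open ≡-Reasoning

ρ₀-⊛-comm : ∀ p q → ρ₀ (p ⊛ q) ↭ ρ₀ (q ⊛ p)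
ρ₀-⊛-comm p q = begin
  ρ₀ (p ⊛ q)                                                ≡⟨ ρ₀-⊛ p q ⟩
  concatMap (λ s → concatMap (λ t → ρ₀-term (s · t)) q) p  ↭⟨ concatMap-comm (λ s t → ρ₀-term (s · t)) p q ⟩
  concatMap (λ t → concatMap (λ s → ρ₀-term (s · t)) p) q  ↭⟨ concatMap⁺ (λ t → concatMap⁺ (λ s → ρ₀-term-·-comm s t) p) q ⟩
  concatMap (λ t → concatMap (λ s → ρ₀-term (t · s)) p) q  ≡⟨ ρ₀-⊛ q p ⟨
  ρ₀ (q ⊛ p)                                                ∎
  where open PermutationReasoning

⊛-assoc : ∀ p q r → (p ⊛ q) ⊛ r ≡ p ⊛ (q ⊛ r)
⊛-assoc p q r = begin
  concatMap (λ s → map (s ·_) r) (concatMap (λ t → map (t ·_) q) p)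
    ≡⟨ concatMap-concatMap _ _ p ⟩
  concatMap (λ t → concatMap (λ s → map (s ·_) r) (map (t ·_) q)) p
    ≡⟨ concatMap-cong (λ t → concatMap-map _ (t ·_) q) p ⟩
  concatMap (λ t → concatMap (λ s → map ((t · s) ·_) r) q) p
    ≡⟨ concatMap-cong (λ t → concatMap-cong (λ s → trans (map-cong (·-assoc t s) r) (map-∘ r)) q) p ⟩
  concatMap (λ t → concatMap (λ s → map (t ·_) (map (s ·_) r)) q) p
    ≡⟨ concatMap-cong (λ t → map-concatMap (t ·_) _ q) p ⟨
  concatMap (λ t → map (t ·_) (concatMap (λ s → map (s ·_) r) q)) p
    ∎
  where open ≡-Reasoning

⊛-identityˡ : ∀ p → one ⊛ p ≡ p
⊛-identityˡ p =
  trans (++-identityʳ _) (trans (map-cong (λ (d , v) → cong (_, v) (ℚₚ.*-identityˡ d)) p) (map-id p))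

prodList : List YZ → 𝔥
prodList = foldr (λ a p → toH a ⊛ p) one

prodYZ≡prodList : ∀ {l} (u : Vec YZ l) → prodYZ u ≡ prodList (toList u)
prodYZ≡prodList Vec.[]      = refl
prodYZ≡prodList (a Vec.∷ u) = cong (toH a ⊛_) (prodYZ≡prodList u)

prodList-++ : ∀ xs ys → prodList (xs ++ ys) ≡ prodList xs ⊛ prodList ys
prodList-++ []       ys = sym (⊛-identityˡ (prodList ys))
prodList-++ (a ∷ xs) ys =
  trans (cong (toH a ⊛_) (prodList-++ xs ys)) (sym (⊛-assoc (toH a) (prodList xs) (prodList ys)))

ρ₀-prodList-rotate : ∀ xs ys → ρ₀ (prodList (xs ++ ys)) ↭ ρ₀ (prodList (ys ++ xs))
ρ₀-prodList-rotate xs ys = begin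
  ρ₀ (prodList (xs ++ ys))        ≡⟨ cong ρ₀ (prodList-++ xs ys) ⟩
  ρ₀ (prodList xs ⊛ prodList ys)  ↭⟨ ρ₀-⊛-comm (prodList xs) (prodList ys) ⟩
  ρ₀ (prodList ys ⊛ prodList xs)  ≡⟨ cong ρ₀ (prodList-++ ys xs) ⟨
  ρ₀ (prodList (ys ++ xs))        ∎
  where open PermutationReasoning

remainder-unique : ∀ {d r r'} (q q' : ℤ) → r < d → r' < d →
                   + r ℤ.+ q ℤ.* + d ≡ + r' ℤ.+ q' ℤ.* + d → r ≡ r'
remainder-unique {d} {r} {r'} q q' r<d r'<d eq = by-∣q'-q∣ ∣ q' ℤ.- q ∣ refl
  where
  r-r'≡[q'-q]d : + r ℤ.- + r' ≡ (q' ℤ.- q) ℤ.* + d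
  r-r'≡[q'-q]d = begin
    + r ℤ.- + r'                                    ≡⟨ shift (+ r) (+ r') (q ℤ.* + d) ⟩
    (+ r ℤ.+ q ℤ.* + d) ℤ.- (+ r' ℤ.+ q ℤ.* + d)    ≡⟨ cong (ℤ._- (+ r' ℤ.+ q ℤ.* + d)) eq ⟩
    (+ r' ℤ.+ q' ℤ.* + d) ℤ.- (+ r' ℤ.+ q ℤ.* + d)  ≡⟨ cancel (+ r') q q' (+ d) ⟩
    (q' ℤ.- q) ℤ.* + d                              ∎
    where
    open ≡-Reasoning
    shift : ∀ a b e → a ℤ.- b ≡ (a ℤ.+ e) ℤ.- (b ℤ.+ e)
    shift = ℤ-Solver.solve-∀
    cancel : ∀ a b c e → (a ℤ.+ c ℤ.* e) ℤ.- (a ℤ.+ b ℤ.* e) ≡ (c ℤ.- b) ℤ.* e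
    cancel = ℤ-Solver.solve-∀

  ∣r-r'∣<d : ∣ + r ℤ.- + r' ∣ < d
  ∣r-r'∣<d = subst (_< d) (cong ∣_∣ (sym (ℤₚ.[+m]-[+n]≡m⊖n r r')))
               (ℕₚ.≤-<-trans (ℤₚ.∣m⊝n∣≤m⊔n r r') (ℕₚ.⊔-lub r<d r'<d))

  by-∣q'-q∣ : ∀ n → ∣ q' ℤ.- q ∣ ≡ n → r ≡ r'
  by-∣q'-q∣ zero    ∣q'-q∣≡0 = ℤₚ.+-injective (ℤₚ.i-j≡0⇒i≡j (+ r) (+ r')
    (trans r-r'≡[q'-q]d (cong (ℤ._* + d) (ℤₚ.∣i∣≡0⇒i≡0 {q' ℤ.- q} ∣q'-q∣≡0))))
  by-∣q'-q∣ (suc n) ∣q'-q∣≡1+n = contradiction d≤∣r-r'∣ (ℕₚ.<⇒≱ ∣r-r'∣<d)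
    where
    ∣r-r'∣≡[1+n]d : ∣ + r ℤ.- + r' ∣ ≡ suc n ℕ.* d
    ∣r-r'∣≡[1+n]d = trans (cong ∣_∣ r-r'≡[q'-q]d)
                      (trans (ℤₚ.∣i*j∣≡∣i∣*∣j∣ (q' ℤ.- q) (+ d)) (cong (ℕ._* d) ∣q'-q∣≡1+n))
    d≤∣r-r'∣ : d ≤ ∣ + r ℤ.- + r' ∣
    d≤∣r-r'∣ = subst (d ≤_) (sym ∣r-r'∣≡[1+n]d) (ℕₚ.m≤n*m d (suc n))

+-%ℕ : ∀ i j l .{{_ : NonZero l}} → (+ i ℤ.+ j) %ℕ l ≡ (i ℕ.+ j %ℕ l) % l
+-%ℕ i j l = remainder-unique ((+ i ℤ.+ j) /ℕ l) (+ (m / l) ℤ.+ q) (n%ℕd<d (+ i ℤ.+ j) l) (m%n<n m l) (begin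
  + ((+ i ℤ.+ j) %ℕ l) ℤ.+ ((+ i ℤ.+ j) /ℕ l) ℤ.* + l  ≡⟨ a≡a%ℕn+[a/ℕn]*n (+ i ℤ.+ j) l ⟨
  + i ℤ.+ j                                            ≡⟨ cong (ℤ._+_ (+ i)) (a≡a%ℕn+[a/ℕn]*n j l) ⟩
  + i ℤ.+ (+ k ℤ.+ q ℤ.* + l)                          ≡⟨ ℤₚ.+-assoc (+ i) (+ k) (q ℤ.* + l) ⟨
  + m ℤ.+ q ℤ.* + l                                    ≡⟨ cong (ℤ._+ q ℤ.* + l) +m≡ ⟩
  (+ (m % l) ℤ.+ + (m / l) ℤ.* + l) ℤ.+ q ℤ.* + l      ≡⟨ regroup (+ (m % l)) (+ (m / l)) q (+ l) ⟩
  + (m % l) ℤ.+ (+ (m / l) ℤ.+ q) ℤ.* + l              ∎)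
  where
  open ≡-Reasoning
  k = j %ℕ l
  q = j /ℕ l
  m = i ℕ.+ k
  +m≡ : + m ≡ + (m % l) ℤ.+ + (m / l) ℤ.* + l
  +m≡ = trans (cong +_ (m≡m%n+[m/n]*n m l))
          (trans (ℤₚ.pos-+ (m % l) _) (cong (ℤ._+_ (+ (m % l))) (ℤₚ.pos-* (m / l) l)))
  regroup : ∀ a b c e → (a ℤ.+ b ℤ.* e) ℤ.+ c ℤ.* e ≡ a ℤ.+ (b ℤ.+ c) ℤ.* e
  regroup = ℤ-Solver.solve-∀

toℕ-shiftIdx : ∀ l {{_ : NonZero l}} j i → toℕ (shiftIdx l j i) ≡ (toℕ i ℕ.+ j %ℕ l) % l
toℕ-shiftIdx l j i = trans (Finₚ.toℕ-fromℕ< _) (+-%ℕ (toℕ i) j l)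

module _ {A : Set} where

  nth : List A → ℕ → Maybe A
  nth []       _       = nothing
  nth (x ∷ xs) zero    = just x
  nth (x ∷ xs) (suc i) = nth xs i

  nth-ext : ∀ {xs ys : List A} → length xs ≡ length ys →
            (∀ i → i < length xs → nth xs i ≡ nth ys i) → xs ≡ ys
  nth-ext {[]}     {[]}     _   _  = refl
  nth-ext {x ∷ xs} {y ∷ ys} len eq = cong₂ _∷_
    (just-injective (eq zero (s≤s ℕ.z≤n)))
    (nth-ext (ℕₚ.suc-injective len) (λ i i<n → eq (suc i) (s≤s i<n)))
    where
    just-injective : ∀ {a b : A} → just a ≡ just b → a ≡ b
    just-injective refl = refl

  nth-toList : ∀ {n} (v : Vec A n) (i : Fin n) → nth (toList v) (toℕ i) ≡ just (lookup v i)
  nth-toList (x Vec.∷ v) Fin.zero    = refl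
  nth-toList (x Vec.∷ v) (Fin.suc i) = nth-toList v i

  nth-++ˡ : ∀ xs ys {i} → i < length xs → nth (xs ++ ys) i ≡ nth xs i
  nth-++ˡ (x ∷ xs) ys {zero}  _         = refl
  nth-++ˡ (x ∷ xs) ys {suc i} (s≤s i<n) = nth-++ˡ xs ys i<n

  nth-++ʳ : ∀ xs ys i → nth (xs ++ ys) (length xs ℕ.+ i) ≡ nth ys i
  nth-++ʳ []       ys i = refl
  nth-++ʳ (x ∷ xs) ys i = nth-++ʳ xs ys i

  nth-rotate : ∀ xs ys {l i} .{{_ : NonZero l}} → length xs ℕ.+ length ys ≡ l → i < l →
               nth (ys ++ xs) i ≡ nth (xs ++ ys) ((i ℕ.+ length xs) % l)
  nth-rotate xs ys {l} {i} len i<l with i <? length ys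
  ... | yes i<∣ys∣ = begin
    nth (ys ++ xs) i                        ≡⟨ nth-++ˡ ys xs i<∣ys∣ ⟩
    nth ys i                                ≡⟨ nth-++ʳ xs ys i ⟨
    nth (xs ++ ys) (length xs ℕ.+ i)        ≡⟨ cong (nth (xs ++ ys)) (ℕₚ.+-comm (length xs) i) ⟩
    nth (xs ++ ys) (i ℕ.+ length xs)        ≡⟨ cong (nth (xs ++ ys)) (m<n⇒m%n≡m i+∣xs∣<l) ⟨
    nth (xs ++ ys) ((i ℕ.+ length xs) % l)  ∎
    where
    open ≡-Reasoning
    i+∣xs∣<l : i ℕ.+ length xs < l
    i+∣xs∣<l = subst (i ℕ.+ length xs <_) (trans (ℕₚ.+-comm (length ys) _) len)
                 (ℕₚ.+-monoˡ-< (length xs) i<∣ys∣)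
  ... | no i≮∣ys∣ = begin
    nth (ys ++ xs) i                        ≡⟨ cong (nth (ys ++ xs)) i≡∣ys∣+m ⟩
    nth (ys ++ xs) (length ys ℕ.+ m)        ≡⟨ nth-++ʳ ys xs m ⟩
    nth xs m                                ≡⟨ nth-++ˡ xs ys m<∣xs∣ ⟨
    nth (xs ++ ys) m                        ≡⟨ cong (nth (xs ++ ys)) (m<n⇒m%n≡m m<l) ⟨
    nth (xs ++ ys) (m % l)                  ≡⟨ cong (nth (xs ++ ys)) ([m+n]%n≡m%n m l) ⟨
    nth (xs ++ ys) ((m ℕ.+ l) % l)          ≡⟨ cong (λ n → nth (xs ++ ys) (n % l)) i+∣xs∣≡m+l ⟨
    nth (xs ++ ys) ((i ℕ.+ length xs) % l)  ∎
    where
    open ≡-Reasoning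
    m = i ℕ.∸ length ys
    i≡∣ys∣+m : i ≡ length ys ℕ.+ m
    i≡∣ys∣+m = sym (ℕₚ.m+[n∸m]≡n (ℕₚ.≮⇒≥ i≮∣ys∣))
    m<∣xs∣ : m < length xs
    m<∣xs∣ = ℕₚ.+-cancelˡ-< (length ys) m (length xs)
               (subst₂ _<_ i≡∣ys∣+m (sym (trans (ℕₚ.+-comm (length ys) _) len)) i<l)
    m<l : m < l
    m<l = subst (m <_) len (ℕₚ.<-≤-trans m<∣xs∣ (ℕₚ.m≤m+n (length xs) (length ys)))
    i+∣xs∣≡m+l : i ℕ.+ length xs ≡ m ℕ.+ l
    i+∣xs∣≡m+l = trans (cong (ℕ._+ length xs) i≡∣ys∣+m) (trans (regroup (length ys) m (length xs)) (cong (m ℕ.+_) len))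
      where
      regroup : ∀ a b c → (a ℕ.+ b) ℕ.+ c ≡ b ℕ.+ (c ℕ.+ a)
      regroup = ℕ-Solver.solve-∀

cyclicEquiv⇒rotation : ∀ l {{_ : NonZero l}} (u v : Vec YZ l) → CyclicEquiv l u v →
                       Σ[ xs ∈ List YZ ] Σ[ ys ∈ List YZ ] toList u ≡ xs ++ ys × toList v ≡ ys ++ xs
cyclicEquiv⇒rotation l u v (j , v≡u∘shift) = xs , ys , us≡xs++ys , nth-ext ∣v∣≡∣ys++xs∣ v≡ys++xs
  where
  us = toList u
  k = j %ℕ l
  xs = take k us
  ys = drop k us
  us≡xs++ys : us ≡ xs ++ ys
  us≡xs++ys = sym (take++drop≡id k us)
  ∣us∣≡l : length us ≡ l
  ∣us∣≡l = Vecₚ.length-toList u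
  ∣xs∣≡k : length xs ≡ k
  ∣xs∣≡k = trans (length-take k us) (trans (cong (k ℕ.⊓_) ∣us∣≡l) (ℕₚ.m≤n⇒m⊓n≡m (ℕₚ.<⇒≤ (n%ℕd<d j l))))
  ∣xs++ys∣≡l : length (xs ++ ys) ≡ l
  ∣xs++ys∣≡l = trans (cong length (sym us≡xs++ys)) ∣us∣≡l
  ∣v∣≡∣ys++xs∣ : length (toList v) ≡ length (ys ++ xs)
  ∣v∣≡∣ys++xs∣ = trans (Vecₚ.length-toList v) (sym (trans (length-++-comm ys xs) ∣xs++ys∣≡l))
  v≡ys++xs : ∀ i → i < length (toList v) → nth (toList v) i ≡ nth (ys ++ xs) i
  v≡ys++xs i i<∣v∣ = begin
    nth (toList v) i                        ≡⟨ cong (nth (toList v)) (Finₚ.toℕ-fromℕ< i<l) ⟨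
    nth (toList v) (toℕ f)                  ≡⟨ nth-toList v f ⟩
    just (lookup v f)                       ≡⟨ cong just (v≡u∘shift f) ⟩
    just (lookup u (shiftIdx l j f))        ≡⟨ nth-toList u (shiftIdx l j f) ⟨
    nth us (toℕ (shiftIdx l j f))           ≡⟨ cong (nth us) (toℕ-shiftIdx l j f) ⟩
    nth us ((toℕ f ℕ.+ k) % l)              ≡⟨ cong₂ (λ ws n → nth ws ((n ℕ.+ k) % l)) us≡xs++ys (Finₚ.toℕ-fromℕ< i<l) ⟩
    nth (xs ++ ys) ((i ℕ.+ k) % l)          ≡⟨ cong (λ n → nth (xs ++ ys) ((i ℕ.+ n) % l)) ∣xs∣≡k ⟨
    nth (xs ++ ys) ((i ℕ.+ length xs) % l)  ≡⟨ nth-rotate xs ys (trans (sym (length-++ xs)) ∣xs++ys∣≡l) i<l ⟨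
    nth (ys ++ xs) i                        ∎
    where
    open ≡-Reasoning
    i<l : i < l
    i<l = subst (i <_) (Vecₚ.length-toList v) i<∣v∣
    f = fromℕ< i<l

proposition5p2 : (l : ℕ) → {{_ : NonZero l}} → (u v : Vec YZ l) →
    CyclicEquiv l u v → ρ₀ (prodYZ u) ≈ ρ₀ (prodYZ v)
proposition5p2 l u v u~v with cyclicEquiv⇒rotation l u v u~v
... | xs , ys , u≡xs++ys , v≡ys++xs = ↭⇒≈ (begin
  ρ₀ (prodYZ u)             ≡⟨ cong ρ₀ (prodYZ≡prodList u) ⟩
  ρ₀ (prodList (toList u))  ≡⟨ cong (ρ₀ ∘ prodList) u≡xs++ys ⟩
  ρ₀ (prodList (xs ++ ys))  ↭⟨ ρ₀-prodList-rotate xs ys ⟩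
  ρ₀ (prodList (ys ++ xs))  ≡⟨ cong (ρ₀ ∘ prodList) v≡ys++xs ⟨
  ρ₀ (prodList (toList v))  ≡⟨ cong ρ₀ (prodYZ≡prodList v) ⟨
  ρ₀ (prodYZ v)             ∎)
  where open PermutationReasoning
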